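{- Let $G$ be a (finite, simple) graph with $m \geq 1$ edges, and let $\prec$ be any fixed total order of the vertices of $G$. Then the edge set of $G$ can be partitioned into at most $\lfloor \sqrt{2m} \rfloor$ sets, each of which is either a stack or a queue with respect to $\prec$. In particular, the mixed page number of $G$ respecting $\prec$ is at most $\lfloor \sqrt{2m} \rfloor$.
   Context: Given a total vertex order $\prec$, two edges $(u_1,v_1)$, $(u_2,v_2)$ with four distinct endpoints and $u_1\prec v_1$, $u_2 \prec v_2$, $u_1 \prec u_2$ are said to cross if $u_1 \prec u_2 \prec v_1 \prec v_2$, and to nest if $u_1 \prec u_2 \prec v_2 \prec v_1$. A stack is a set of edges no two of which cross; a queue is a set of edges no two of which nest (edges sharing an endpoint never cross or nest). An $s$-stack $q$-queue layout of $G$ consists of a total vertex order together with a partition of the edges into $s$ stacks and $q$ queues. The mixed page number of $G$ respecting a fixed order $\prec$ is the minimum $s+q$ over all $s$-stack $q$-queue layouts using the order $\prec$. -}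

module Defs where

open import Data.Nat using (ℕ; _*_; _≤_)
open import Data.Fin using (Fin)
open import Data.Product using (_×_; _,_; ∃; ∃-syntax; proj₁; proj₂)
open import Data.Sum using (_⊎_)
open import Data.List using (List; length; lookup)
open import Relation.Binary.PropositionalEquality using (_≡_; _≢_)
open import Relation.Nullary using (¬_)
open import Relation.Binary.Structures using (IsStrictTotalOrder)

-- An (undirected) edge is stored as a pair of vertices; its orientation is irrelevant.
Edge : ℕ → Set
Edge n = Fin n × Fin n

_orients_ : ∀ {n} → Fin n × Fin n → Edge n → Set
(u , v) orients (a , b) = ((u ≡ a) × (v ≡ b)) ⊎ ((u ≡ b) × (v ≡ a))

SameEdge : ∀ {n} → Edge n → Edge n → Set
SameEdge e f = f orients e

record SimpleGraph (n : ℕ) : Set where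
  field
    edges     : List (Edge n)
    loopless  : ∀ i → proj₁ (lookup edges i) ≢ proj₂ (lookup edges i)
    noMulti   : ∀ i j → SameEdge (lookup edges i) (lookup edges j) → i ≡ j

module _ {n : ℕ} (_≺_ : Fin n → Fin n → Set) where

  CrossOrd : Edge n → Edge n → Set
  CrossOrd e f = ∃[ u₁ ] ∃[ v₁ ] ∃[ u₂ ] ∃[ v₂ ]
    ((u₁ , v₁) orients e) × ((u₂ , v₂) orients f) ×
    (u₁ ≺ u₂) × (u₂ ≺ v₁) × (v₁ ≺ v₂)

  Cross : Edge n → Edge n → Set
  Cross e f = CrossOrd e f ⊎ CrossOrd f e

  NestOrd : Edge n → Edge n → Set
  NestOrd e f = ∃[ u₁ ] ∃[ v₁ ] ∃[ u₂ ] ∃[ v₂ ]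
    ((u₁ , v₁) orients e) × ((u₂ , v₂) orients f) ×
    (u₁ ≺ u₂) × (u₂ ≺ v₂) × (v₂ ≺ v₁)

  Nest : Edge n → Edge n → Set
  Nest e f = NestOrd e f ⊎ NestOrd f e

  IsStack : (P : Edge n → Set) → Set
  IsStack P = ∀ e f → P e → P f → ¬ Cross e f

  IsQueue : (P : Edge n → Set) → Set
  IsQueue P = ∀ e f → P e → P f → ¬ Nest e f

  record StackQueuePartition (G : SimpleGraph n) (k : ℕ) : Set where
    open SimpleGraph G
    field
      colour  : Fin (length edges) → Fin k
      classOK : ∀ c → IsStack (λ e → ∃[ i ] (colour i ≡ c) × (lookup edges i ≡ e))
                    ⊎ IsQueue (λ e → ∃[ i ] (colour i ≡ c) × (lookup edges i ≡ e))

-- With the vertex order fixed, "e encloses f" (nesting in a fixed direction) is a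
-- strict partial order on the edges.  Two comparable edges never cross and two
-- incomparable edges never nest, so a chain of this order is a stack and an
-- antichain is a queue.  A poset with N elements, 2N < (r+1)(r+2), splits into r
-- chains and antichains: if it has a chain of r+1 elements, remove it and
-- recurse (the bound drops to r(r+1) since (r+1)(r+2) = r(r+1) + 2(r+1));
-- otherwise the length of the longest chain ending at an element takes fewer
-- than r values, and its level sets are antichains (Mirsky).  Taking
-- r = ⌊√(2m)⌋ gives 2m < (r+1)² ≤ (r+1)(r+2).
module Submission where

open import Defs
open import Data.Nat using (ℕ; zero; suc; _+_; _*_; _≤_; _<_; _≤?_; z≤n; s≤s)
open import Data.Nat.Properties using (n<1+n; n≤1+n; <-≤-trans; m<n⇒m<1+n; m≤n⇒m≤1+n; ≤-trans; ≰⇒>; *-mono-<; +-suc; +-monoʳ-≤; *-monoʳ-≤; +-cancelʳ-<; n≮0; module ≤-Reasoning)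
open import Data.Nat.Tactic.RingSolver using (solve-∀)
open import Data.Fin using (Fin; fromℕ<) renaming (_≟_ to _≟ᶠ_)
open import Data.Fin.Properties using (any?; fromℕ<-injective)
open import Data.Fin.Subset using (Subset; _∈_; _∉_; _-_; ∣_∣; ⊤)
open import Data.Fin.Subset.Properties using (_∈?_; ∈⊤; ∣⊤∣≡n; x∈p∧x≢y⇒x∈p-y; x∈p⇒∣p-x∣<∣p∣)
open import Data.List using (length; lookup)
open import Data.Product using (∃-syntax; _×_; _,_; proj₁; proj₂)
open import Data.Sum using (_⊎_; inj₁; inj₂; swap)
open import Level using (0ℓ)
open import Relation.Nullary using (¬_; Dec; yes; no; contradiction)
open import Relation.Nullary.Decidable using (map′; decidable-stable; _×-dec_; _⊎-dec_)
open import Relation.Unary using (Pred; _⊆_)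
open import Relation.Binary.Core using (Rel)
open import Relation.Binary.Definitions using (Decidable; Transitive)
open import Relation.Binary.Structures using (IsStrictTotalOrder; IsDecStrictPartialOrder)
open import Relation.Binary.PropositionalEquality using (_≡_; refl; sym; subst; isEquivalence; resp₂)
open import Function using (_∘_)

boundary : {P : Pred ℕ 0ℓ} → (∀ t → Dec (P t)) → P 0 →
           ∀ n → ¬ P n → ∃[ t ] t < n × P t × ¬ P (suc t)
boundary P? P0 zero ¬Pn = contradiction P0 ¬Pn
boundary P? P0 (suc n) ¬Psn with P? n
... | yes Pn = n , n<1+n n , Pn , ¬Psn
... | no ¬Pn with boundary P? P0 n ¬Pn
...   | t , t<n , Pt , ¬Pst = t , m<n⇒m<1+n t<n , Pt , ¬Pst

integerSqrt : ∀ N → ∃[ k ] k * k ≤ N × N < suc k * suc k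
integerSqrt zero = 0 , z≤n , s≤s z≤n
integerSqrt (suc N) with integerSqrt N
... | k , k²≤N , N<[k+1]² with suc k * suc k ≤? suc N
...   | yes [k+1]²≤N+1 =
  suc k , [k+1]²≤N+1 , ≤-trans (s≤s N<[k+1]²) (*-mono-< (n<1+n (suc k)) (n<1+n (suc k)))
...   | no [k+1]²≰N+1 = k , m≤n⇒m≤1+n k²≤N , ≰⇒> [k+1]²≰N+1

shrink-bound : ∀ r {a b} → suc r + a ≤ b → 2 * b < suc r * suc (suc r) → 2 * a < r * suc r
shrink-bound r {a} {b} r+1+a≤b 2b<[r+1][r+2] = +-cancelʳ-< (2 * suc r) (2 * a) (r * suc r) (begin-strict
  2 * a + 2 * suc r     ≡⟨ double-sum r a ⟩
  2 * (suc r + a)       ≤⟨ *-monoʳ-≤ 2 r+1+a≤b ⟩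
  2 * b                 <⟨ 2b<[r+1][r+2] ⟩
  suc r * suc (suc r)   ≡⟨ product-step r ⟩
  r * suc r + 2 * suc r ∎)
  where
    open ≤-Reasoning
    double-sum : ∀ r a → 2 * a + 2 * suc r ≡ 2 * (suc r + a)
    double-sum = solve-∀
    product-step : ∀ r → suc r * suc (suc r) ≡ r * suc r + 2 * suc r
    product-step = solve-∀

x∉p-y⇒x≡y⊎x∉p : ∀ {m} {p : Subset m} {x y} → x ∉ p - y → x ≡ y ⊎ x ∉ p
x∉p-y⇒x≡y⊎x∉p {x = x} {y} x∉p-y with x ≟ᶠ y
... | yes x≡y = inj₁ x≡y
... | no x≢y = inj₂ λ x∈p → x∉p-y (x∈p∧x≢y⇒x∈p-y x∈p x≢y)

module ChainAntichainPartition {m : ℕ} {_⊏_ : Rel (Fin m) 0ℓ}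
                               (isDecStrictPartialOrder : IsDecStrictPartialOrder _≡_ _⊏_) where
  open IsDecStrictPartialOrder isDecStrictPartialOrder using (irrefl; trans) renaming (_<?_ to _⊏?_)

  Comparable : Rel (Fin m) 0ℓ
  Comparable x y = x ≡ y ⊎ x ⊏ y ⊎ y ⊏ x

  IsChain : Pred (Fin m) 0ℓ → Set
  IsChain P = ∀ x y → P x → P y → Comparable x y

  IsAntichain : Pred (Fin m) 0ℓ → Set
  IsAntichain P = ∀ x y → P x → P y → ¬ x ⊏ y

  isChain-⊆ : ∀ {P Q} → P ⊆ Q → IsChain Q → IsChain P
  isChain-⊆ P⊆Q isChain x y Px Py = isChain x y (P⊆Q Px) (P⊆Q Py)

  isAntichain-⊆ : ∀ {P Q} → P ⊆ Q → IsAntichain Q → IsAntichain P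
  isAntichain-⊆ P⊆Q isAntichain x y Px Py = isAntichain x y (P⊆Q Px) (P⊆Q Py)

  record Partition (A : Subset m) (r : ℕ) : Set where
    field
      colour : ∀ x → x ∈ A → Fin r

    ColourClass : Fin r → Pred (Fin m) 0ℓ
    ColourClass c x = ∃[ x∈A ] colour x x∈A ≡ c

    field
      chainOrAntichain : ∀ c → IsChain (ColourClass c) ⊎ IsAntichain (ColourClass c)

  -- Chain A t y: a chain of t + 1 elements of A whose largest element is y.
  data Chain (A : Subset m) : ℕ → Fin m → Set where
    [_]  : ∀ {y} → y ∈ A → Chain A 0 y
    snoc : ∀ {t x y} → Chain A t x → x ⊏ y → y ∈ A → Chain A (suc t) y

  chain? : ∀ A t y → Dec (Chain A t y)
  chain? A zero y = map′ [_] (λ { [ y∈A ] → y∈A }) (y ∈? A)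
  chain? A (suc t) y =
    map′ (λ { ((x , c , x⊏y) , y∈A) → snoc c x⊏y y∈A })
         (λ { (snoc c x⊏y y∈A) → (_ , c , x⊏y) , y∈A })
         (any? (λ x → chain? A t x ×-dec x ⊏? y) ×-dec y ∈? A)

  antichainPartition : ∀ {A r} → (∀ y → ¬ Chain A r y) → Partition A r
  antichainPartition {A} {r} noLongChain = record
    { colour           = λ y y∈A → fromℕ< (height<r y y∈A)
    ; chainOrAntichain = λ c → inj₂ (sameHeight⇒incomparable c)
    }
    where
      height : ∀ y → y ∈ A → ∃[ h ] h < r × Chain A h y × ¬ Chain A (suc h) y
      height y y∈A = boundary (λ t → chain? A t y) [ y∈A ] r (noLongChain y)

      height<r : ∀ y (y∈A : y ∈ A) → proj₁ (height y y∈A) < r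
      height<r y y∈A = proj₁ (proj₂ (height y y∈A))

      sameHeight⇒incomparable : ∀ c → IsAntichain (λ x → ∃[ x∈A ] fromℕ< (height<r x x∈A) ≡ c)
      sameHeight⇒incomparable c x y (x∈A , refl) (y∈A , sameColour) x⊏y
        with height x x∈A | height y y∈A
      ... | h , h<r , chainₓ , _ | h′ , h′<r , _ , ¬longer =
        ¬longer (subst (λ k → Chain A (suc k) y) (fromℕ<-injective h h′ h<r h′<r (sym sameColour))
                       (snoc chainₓ x⊏y y∈A))

  extendByChain : ∀ {A A′ r} → IsChain (λ x → x ∈ A × x ∉ A′) → Partition A′ r → Partition A (suc r)
  extendByChain {A} {A′} {r} isChain R = record
    { colour           = λ x _ → colourBy (x ∈? A′)
    ; chainOrAntichain = chainOrAntichain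
    }
    where
      module R = Partition R
      open Data.Fin using (zero; suc)

      colourBy : ∀ {x} → Dec (x ∈ A′) → Fin (suc r)
      colourBy (yes x∈A′) = suc (R.colour _ x∈A′)
      colourBy (no _)     = zero

      zero-class : ∀ {x} (d : Dec (x ∈ A′)) → colourBy d ≡ zero → x ∉ A′
      zero-class (no x∉A′) _ = x∉A′

      suc-class : ∀ {x c} (d : Dec (x ∈ A′)) → colourBy d ≡ suc c → R.ColourClass c x
      suc-class (yes x∈A′) refl = x∈A′ , refl

      Class : Fin (suc r) → Pred (Fin m) 0ℓ
      Class c x = x ∈ A × colourBy (x ∈? A′) ≡ c

      chainOrAntichain : ∀ c → IsChain (Class c) ⊎ IsAntichain (Class c)
      chainOrAntichain zero = inj₁ λ x y (x∈A , cx) (y∈A , cy) →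
        isChain x y (x∈A , zero-class (x ∈? A′) cx) (y∈A , zero-class (y ∈? A′) cy)
      chainOrAntichain (suc c) with R.chainOrAntichain c
      ... | inj₁ isChainᶜ     = inj₁ λ x y (_ , cx) (_ , cy) →
        isChainᶜ x y (suc-class (x ∈? A′) cx) (suc-class (y ∈? A′) cy)
      ... | inj₂ isAntichainᶜ = inj₂ λ x y (_ , cx) (_ , cy) →
        isAntichainᶜ x y (suc-class (x ∈? A′) cx) (suc-class (y ∈? A′) cy)

  without : ∀ {A t y} → Chain A t y → Subset m
  without {A} {y = y} [ _ ] = A - y
  without {y = y} (snoc c _ _) = without c - y

  ∉-without⇒< : ∀ {A t x x′ y} (c : Chain A t x′) → x ∈ A → x ∉ without c → x′ ⊏ y → x ⊏ y
  ∉-without⇒< [ _ ] x∈A x∉ x′⊏y with x∉p-y⇒x≡y⊎x∉p x∉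
  ... | inj₁ refl = x′⊏y
  ... | inj₂ x∉A = contradiction x∈A x∉A
  ∉-without⇒< (snoc c z⊏x′ _) x∈A x∉ x′⊏y with x∉p-y⇒x≡y⊎x∉p x∉
  ... | inj₁ refl = x′⊏y
  ... | inj₂ x∉w = ∉-without⇒< c x∈A x∉w (trans z⊏x′ x′⊏y)

  without-isChain : ∀ {A t y} (c : Chain A t y) → IsChain (λ x → x ∈ A × x ∉ without c)
  without-isChain [ _ ] x z (x∈A , x∉) (z∈A , z∉) with x∉p-y⇒x≡y⊎x∉p x∉ | x∉p-y⇒x≡y⊎x∉p z∉
  ... | inj₁ refl | inj₁ refl = inj₁ refl
  ... | inj₂ x∉A | _ = contradiction x∈A x∉A
  ... | _ | inj₂ z∉A = contradiction z∈A z∉A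
  without-isChain (snoc c x′⊏y _) x z (x∈A , x∉) (z∈A , z∉) with x∉p-y⇒x≡y⊎x∉p x∉ | x∉p-y⇒x≡y⊎x∉p z∉
  ... | inj₁ refl | inj₁ refl = inj₁ refl
  ... | inj₁ refl | inj₂ z∉w = inj₂ (inj₂ (∉-without⇒< c z∈A z∉w x′⊏y))
  ... | inj₂ x∉w | inj₁ refl = inj₂ (inj₁ (∉-without⇒< c x∈A x∉w x′⊏y))
  ... | inj₂ x∉w | inj₂ z∉w = without-isChain c x z (x∈A , x∉w) (z∈A , z∉w)

  ∈-without : ∀ {A t x y} (c : Chain A t x) → x ⊏ y → y ∈ A → y ∈ without c
  ∈-without c x⊏y y∈A = decidable-stable (_ ∈? without c) λ y∉ → irrefl refl (∉-without⇒< c y∈A y∉ x⊏y)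

  ∣without∣ : ∀ {A t y} (c : Chain A t y) → suc t + ∣ without c ∣ ≤ ∣ A ∣
  ∣without∣ [ y∈A ] = x∈p⇒∣p-x∣<∣p∣ y∈A
  ∣without∣ {A} {suc t} {y} (snoc c x⊏y y∈A) = begin
    suc (suc t) + ∣ without c - y ∣ ≡⟨ +-suc (suc t) _ ⟨
    suc t + suc ∣ without c - y ∣   ≤⟨ +-monoʳ-≤ (suc t) (x∈p⇒∣p-x∣<∣p∣ (∈-without c x⊏y y∈A)) ⟩
    suc t + ∣ without c ∣           ≤⟨ ∣without∣ c ⟩
    ∣ A ∣                           ∎
    where open ≤-Reasoning

  partition : ∀ r A → 2 * ∣ A ∣ < suc r * suc (suc r) → Partition A r
  partition r A bound with any? (chain? A r)
  ... | no ∄longChain = antichainPartition (λ y c → ∄longChain (y , c))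
  partition zero A bound | yes (_ , c) = contradiction (shrink-bound 0 (∣without∣ c) bound) n≮0
  partition (suc r) A bound | yes (_ , c) =
    extendByChain (without-isChain c) (partition r (without c) (shrink-bound (suc r) (∣without∣ c) bound))

module Nesting {n : ℕ} {_≺_ : Rel (Fin n) 0ℓ} (isStrictTotalOrder : IsStrictTotalOrder _≡_ _≺_) where
  open IsStrictTotalOrder isStrictTotalOrder using (irrefl; asym; _<?_) renaming (trans to ≺-trans)

  orientation-unique : ∀ {u v u′ v′} (e : Edge n) → (u , v) orients e → (u′ , v′) orients e →
                       u ≺ v → u′ ≺ v′ → u ≡ u′ × v ≡ v′
  orientation-unique e (inj₁ (refl , refl)) (inj₁ (refl , refl)) _   _   = refl , refl
  orientation-unique e (inj₁ (refl , refl)) (inj₂ (refl , refl)) u≺v v≺u = contradiction v≺u (asym u≺v)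
  orientation-unique e (inj₂ (refl , refl)) (inj₁ (refl , refl)) u≺v v≺u = contradiction v≺u (asym u≺v)
  orientation-unique e (inj₂ (refl , refl)) (inj₂ (refl , refl)) _   _   = refl , refl

  orients? : ∀ p (e : Edge n) → Dec (p orients e)
  orients? (u , v) (a , b) = (u ≟ᶠ a ×-dec v ≟ᶠ b) ⊎-dec (u ≟ᶠ b ×-dec v ≟ᶠ a)

  nest? : Decidable (NestOrd _≺_)
  nest? e f = any? λ u₁ → any? λ v₁ → any? λ u₂ → any? λ v₂ →
    orients? (u₁ , v₁) e ×-dec orients? (u₂ , v₂) f ×-dec u₁ <? u₂ ×-dec u₂ <? v₂ ×-dec v₂ <? v₁

  nest-trans : Transitive (NestOrd _≺_)
  nest-trans {_} {f} (u₁ , v₁ , u₂ , v₂ , o₁ , o₂ , u₁≺u₂ , u₂≺v₂ , v₂≺v₁)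
                     (u₂′ , v₂′ , u₃ , v₃ , o₂′ , o₃ , u₂′≺u₃ , u₃≺v₃ , v₃≺v₂′)
    with orientation-unique f o₂ o₂′ u₂≺v₂ (≺-trans u₂′≺u₃ (≺-trans u₃≺v₃ v₃≺v₂′))
  ... | refl , refl = u₁ , v₁ , u₃ , v₃ , o₁ , o₃ , ≺-trans u₁≺u₂ u₂′≺u₃ , u₃≺v₃ , ≺-trans v₃≺v₂′ v₂≺v₁

  nest-irrefl : ∀ {e} → ¬ NestOrd _≺_ e e
  nest-irrefl {e} (u₁ , v₁ , u₂ , v₂ , o₁ , o₂ , u₁≺u₂ , u₂≺v₂ , v₂≺v₁)
    with orientation-unique e o₁ o₂ (≺-trans u₁≺u₂ (≺-trans u₂≺v₂ v₂≺v₁)) u₂≺v₂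
  ... | refl , refl = irrefl refl u₁≺u₂

  ¬crossOrd-self : ∀ {e} → ¬ CrossOrd _≺_ e e
  ¬crossOrd-self {e} (u₁ , v₁ , u₂ , v₂ , o₁ , o₂ , u₁≺u₂ , u₂≺v₁ , v₁≺v₂)
    with orientation-unique e o₁ o₂ (≺-trans u₁≺u₂ u₂≺v₁) (≺-trans u₂≺v₁ v₁≺v₂)
  ... | refl , refl = irrefl refl u₁≺u₂

  ¬cross-self : ∀ {e} → ¬ Cross _≺_ e e
  ¬cross-self (inj₁ crossing) = ¬crossOrd-self crossing
  ¬cross-self (inj₂ crossing) = ¬crossOrd-self crossing

  nest⇒¬cross : ∀ {e f} → NestOrd _≺_ e f → ¬ Cross _≺_ e f
  nest⇒¬cross {e} {f} (u₁ , v₁ , u₂ , v₂ , o₁ , o₂ , u₁≺u₂ , u₂≺v₂ , v₂≺v₁)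
                      (inj₁ (x₁ , y₁ , x₂ , y₂ , p₁ , p₂ , x₁≺x₂ , x₂≺y₁ , y₁≺y₂))
    with orientation-unique e o₁ p₁ (≺-trans u₁≺u₂ (≺-trans u₂≺v₂ v₂≺v₁)) (≺-trans x₁≺x₂ x₂≺y₁)
       | orientation-unique f o₂ p₂ u₂≺v₂ (≺-trans x₂≺y₁ y₁≺y₂)
  ... | refl , refl | refl , refl = asym v₂≺v₁ y₁≺y₂
  nest⇒¬cross {e} {f} (u₁ , v₁ , u₂ , v₂ , o₁ , o₂ , u₁≺u₂ , u₂≺v₂ , v₂≺v₁)
                      (inj₂ (x₁ , y₁ , x₂ , y₂ , p₁ , p₂ , x₁≺x₂ , x₂≺y₁ , y₁≺y₂))
    with orientation-unique f o₂ p₁ u₂≺v₂ (≺-trans x₁≺x₂ x₂≺y₁)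
       | orientation-unique e o₁ p₂ (≺-trans u₁≺u₂ (≺-trans u₂≺v₂ v₂≺v₁)) (≺-trans x₂≺y₁ y₁≺y₂)
  ... | refl , refl | refl , refl = asym u₁≺u₂ x₁≺x₂

module EdgeNesting {n : ℕ} (G : SimpleGraph n) {_≺_ : Rel (Fin n) 0ℓ}
                   (isStrictTotalOrder : IsStrictTotalOrder _≡_ _≺_) where
  open SimpleGraph G
  open Nesting isStrictTotalOrder

  edge : Fin (length edges) → Edge n
  edge = lookup edges

  _⊏_ : Rel (Fin (length edges)) 0ℓ
  i ⊏ j = NestOrd _≺_ (edge i) (edge j)

  ⊏-isDecStrictPartialOrder : IsDecStrictPartialOrder _≡_ _⊏_
  ⊏-isDecStrictPartialOrder = record
    { isStrictPartialOrder = record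
      { isEquivalence = isEquivalence
      ; irrefl        = λ { refl → nest-irrefl }
      ; trans         = nest-trans
      ; <-resp-≈      = resp₂ _⊏_
      }
    ; _≟_  = _≟ᶠ_
    ; _<?_ = λ i j → nest? (edge i) (edge j)
    }

  open ChainAntichainPartition ⊏-isDecStrictPartialOrder

  chain⇒stack : ∀ {P} → IsChain P → IsStack _≺_ (λ e → ∃[ i ] P i × edge i ≡ e)
  chain⇒stack isChain _ _ (i , Pi , refl) (j , Pj , refl) with isChain i j Pi Pj
  ... | inj₁ refl        = ¬cross-self
  ... | inj₂ (inj₁ i⊏j) = nest⇒¬cross i⊏j
  ... | inj₂ (inj₂ j⊏i) = nest⇒¬cross j⊏i ∘ swap

  antichain⇒queue : ∀ {P} → IsAntichain P → IsQueue _≺_ (λ e → ∃[ i ] P i × edge i ≡ e)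
  antichain⇒queue isAntichain _ _ (i , Pi , refl) (j , Pj , refl) (inj₁ i⊏j) = isAntichain i j Pi Pj i⊏j
  antichain⇒queue isAntichain _ _ (i , Pi , refl) (j , Pj , refl) (inj₂ j⊏i) = isAntichain j i Pj Pi j⊏i

  stackQueuePartition : ∀ k → 2 * length edges < suc k * suc (suc k) → StackQueuePartition _≺_ G k
  stackQueuePartition k bound = record
    { colour  = λ i → colour i ∈⊤
    ; classOK = λ c → Data.Sum.map (chain⇒stack ∘ isChain-⊆ (∈⊤ ,_)) (antichain⇒queue ∘ isAntichain-⊆ (∈⊤ ,_))
                                (chainOrAntichain c)
    }
    where open Partition (partition k ⊤ (subst (λ N → 2 * N < suc k * suc (suc k)) (sym (∣⊤∣≡n (length edges))) bound))

theorem1 : (n : ℕ) (G : SimpleGraph n) (_≺_ : Fin n → Fin n → Set) →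
    IsStrictTotalOrder _≡_ _≺_ →
    1 ≤ length (SimpleGraph.edges G) →
    ∃[ k ] (k * k ≤ 2 * length (SimpleGraph.edges G)) ×
    StackQueuePartition _≺_ G k
theorem1 n G _≺_ isStrictTotalOrder _ with integerSqrt (2 * length (SimpleGraph.edges G))
... | k , k²≤2m , 2m<[k+1]² =
  k , k²≤2m , EdgeNesting.stackQueuePartition G isStrictTotalOrder k
                (<-≤-trans 2m<[k+1]² (*-monoʳ-≤ (suc k) (n≤1+n (suc k))))
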